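{- Let $G$ be a graph, $s,t\in V(G)$, $k$ a positive integer, and let $S,T\subseteq V(G)$ satisfy: $s\in S$, $t\in T$, $S\cap T=\emptyset$, $G[S]$ and $G[T]$ are connected, and there is no edge between $S$ and $T$. If $|N(S)\cap N(T)|\geq k$, then $G$ has a minimal $st$-separator of size at least $k$.
   Context: All graphs are finite, simple and undirected. For $X\subseteq V(G)$, $N(X)$ denotes the set of vertices not in $X$ that have a neighbour in $X$. An $st$-separator is a set $Z\subseteq V(G)\setminus\{s,t\}$ such that $G-Z$ has no $s$–$t$ path; it is minimal if no proper subset is an $st$-separator. -}

module Defs where

open import Data.Nat using (ℕ; _≥_)
open import Data.Fin using (Fin)
open import Data.Fin.Subset using (Subset; _∈_; _∉_; _⊂_; _∩_; ∣_∣; Empty)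
open import Data.Fin.Subset.Properties using (_∈?_)
open import Data.Fin.Properties using (any?)
open import Data.Product using (_×_; ∃-syntax)
open import Data.Vec using (tabulate)
open import Relation.Nullary using (¬_; Dec; yes; no)
open import Relation.Nullary.Decidable using (⌊_⌋; _×-dec_; ¬?)
open import Data.Bool using (Bool)

record Graph (n : ℕ) : Set₁ where
  field
    Adj      : Fin n → Fin n → Set
    adj?     : ∀ u v → Dec (Adj u v)
    sym      : ∀ {u v} → Adj u v → Adj v u
    irrefl   : ∀ {u} → ¬ Adj u u

module _ {n : ℕ} (G : Graph n) where
  open Graph G

  data WalkIn (X : Subset n) : Fin n → Fin n → Set where
    here : ∀ {x} → x ∈ X → WalkIn X x x
    step : ∀ {x y z} → x ∈ X → Adj x y → WalkIn X y z → WalkIn X x z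

  -- G[X] is connected (vertex set X nonempty or not: every two vertices of X
  -- are joined by a path inside X).
  Connected : Subset n → Set
  Connected X = ∀ {x y} → x ∈ X → y ∈ X → WalkIn X x y

  -- Complement of Z: the vertex set of G - Z.
  -- (v ∈ outside Z  iff  v ∉ Z)
  outside : Subset n → Subset n
  outside Z = tabulate (λ v → ⌊ ¬? (v ∈? Z) ⌋)

  Nbhd : Subset n → Subset n
  Nbhd X = tabulate (λ v → ⌊ ¬? (v ∈? X) ×-dec any? (λ u → (u ∈? X) ×-dec adj? u v) ⌋)

  IsSeparator : Fin n → Fin n → Subset n → Set
  IsSeparator s t Z = s ∉ Z × t ∉ Z × ¬ WalkIn (outside Z) s t

  IsMinimalSeparator : Fin n → Fin n → Subset n → Set
  IsMinimalSeparator s t Z =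
    IsSeparator s t Z × (∀ Z′ → Z′ ⊂ Z → ¬ IsSeparator s t Z′)

  NoEdgeBetween : Subset n → Subset n → Set
  NoEdgeBetween S T = ∀ {u v} → u ∈ S → v ∈ T → ¬ Adj u v

{-# OPTIONS --safe #-}
module Submission where

-- Let D be the component of G − N(S) containing t, and Z = N(D). Then Z ⊆ N(S), so S and D
-- avoid Z. A walk from s to t avoiding N(D) must start in D, so it joins s to t avoiding N(S),
-- and then it cannot leave S ∌ t. Every vertex of Z has a neighbour in S and one in D, so
-- removing it from Z reconnects s and t: Z is minimal. As T is connected and misses N(S),
-- T ⊆ D, so each vertex of N(S) ∩ N(T) is adjacent to D without lying in it, i.e. lies in Z.

open import Defs
open import Data.Bool.Properties using (T-≡)
open import Data.Nat using (ℕ; zero; suc; _≥_; NonZero; _<_; s≤s)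
open import Data.Nat.Properties using (≤-trans; <-≤-trans; ≤-pred)
open import Data.Fin using (Fin; zero; suc; _≟_)
open import Data.Fin.Subset using (Subset; _∈_; _∉_; _∩_; ∣_∣; Empty; _⊆_; _⊂_; _-_)
open import Data.Fin.Subset.Properties
  using (_∈?_; x∈p∩q⁺; x∈p∩q⁻; p⊆q⇒∣p∣≤∣q∣; ∣p∣≤n; p─q⊆p; x∈p∧x≢y⇒x∈p-y; x∈p⇒∣p-x∣<∣p∣)
open import Data.Fin.Properties using (any?)
open import Data.Product using (_×_; _,_; proj₁; ∃-syntax)
open import Data.Sum using (_⊎_; inj₁; inj₂)
open import Data.Vec using (_∷_; tabulate; here; there)
open import Data.Vec.Properties using (lookup∘tabulate; []=⇒lookup; lookup⇒[]=)
open import Function using (_∘_; case_of_)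
open import Function.Bundles using (Equivalence)
open import Relation.Nullary using (¬_; ¬?; Dec; yes; no; contradiction; contraposition)
open import Relation.Nullary.Decidable using (⌊_⌋; _×-dec_; toWitness; fromWitness; decidable-stable)
open import Relation.Unary using (Pred; Decidable)
open import Relation.Binary.PropositionalEquality using (_≢_; refl; trans) renaming (sym to ≡-sym)

module _ {n ℓ} {P : Pred (Fin n) ℓ} (P? : Decidable P) where

  ∈-tabulate⌊⌋⁺ : ∀ {v} → P v → v ∈ tabulate (λ u → ⌊ P? u ⌋)
  ∈-tabulate⌊⌋⁺ {v} p =
    lookup⇒[]= v _ (trans (lookup∘tabulate _ v) (Equivalence.to T-≡ (fromWitness p)))

  ∈-tabulate⌊⌋⁻ : ∀ {v} → v ∈ tabulate (λ u → ⌊ P? u ⌋) → P v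
  ∈-tabulate⌊⌋⁻ {v} v∈ =
    toWitness (Equivalence.from T-≡ (trans (≡-sym (lookup∘tabulate _ v)) ([]=⇒lookup v∈)))

x∉p-x : ∀ {n} (p : Subset n) x → x ∉ p - x
x∉p-x (_ ∷ p) zero    ()
x∉p-x (_ ∷ p) (suc x) (there x∈p-x) = x∉p-x p x x∈p-x

module _ {n} (G : Graph n) where
  open Graph G

  private
    variable
      A B X Y : Subset n
      t u v x y z : Fin n

  WalkIn-head : WalkIn G X x y → x ∈ X
  WalkIn-head (here x∈X)     = x∈X
  WalkIn-head (step x∈X _ _) = x∈X

  WalkIn-last : WalkIn G X x y → y ∈ X
  WalkIn-last (here y∈X)   = y∈X
  WalkIn-last (step _ _ w) = WalkIn-last w

  WalkIn-mono : X ⊆ Y → WalkIn G X x y → WalkIn G Y x y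
  WalkIn-mono X⊆Y (here x∈X)      = here (X⊆Y x∈X)
  WalkIn-mono X⊆Y (step x∈X xy w) = step (X⊆Y x∈X) xy (WalkIn-mono X⊆Y w)

  WalkIn-trans : WalkIn G X x y → WalkIn G X y z → WalkIn G X x z
  WalkIn-trans (here _)        w′ = w′
  WalkIn-trans (step x∈X xy w) w′ = step x∈X xy (WalkIn-trans w w′)

  -- The second alternative arises from the last visit of the walk to x.
  WalkIn-bypass : x ≢ z → WalkIn G X y z →
    WalkIn G (X - x) y z ⊎ ∃[ x′ ] (Adj x x′ × WalkIn G (X - x) x′ z)
  WalkIn-bypass {x = x} x≢z (here {y} y∈X) with y ≟ x
  ... | yes refl = contradiction refl x≢z
  ... | no y≢x   = inj₁ (here (x∈p∧x≢y⇒x∈p-y y∈X y≢x))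
  WalkIn-bypass {x = x} x≢z (step {y} y∈X yy′ w) with WalkIn-bypass x≢z w
  ... | inj₂ bypass = inj₂ bypass
  ... | inj₁ w′ with y ≟ x
  ...   | yes refl = inj₂ (_ , yy′ , w′)
  ...   | no y≢x   = inj₁ (step (x∈p∧x≢y⇒x∈p-y y∈X y≢x) yy′ w′)

  WalkIn? : ∀ X x y → Dec (WalkIn G X x y)
  WalkIn? X = bounded (suc n) X (s≤s (∣p∣≤n X))
    where
    bounded : ∀ m X → ∣ X ∣ < m → ∀ x y → Dec (WalkIn G X x y)
    bounded zero    _ ()       _ _
    bounded (suc m) X ∣X∣<1+m x y with x ∈? X | x ≟ y
    ... | no  x∉X | _        = no (λ w → x∉X (WalkIn-head w))
    ... | yes x∈X | yes refl = yes (here x∈X)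
    ... | yes x∈X | no x≢y
        with any? (λ x′ → adj? x x′ ×-dec bounded m (X - x) ∣X-x∣<m x′ y)
      where
      ∣X-x∣<m : ∣ X - x ∣ < m
      ∣X-x∣<m = <-≤-trans (x∈p⇒∣p-x∣<∣p∣ x∈X) (≤-pred ∣X∣<1+m)
    ...   | yes (x′ , xx′ , w) = yes (step x∈X xx′ (WalkIn-mono (p─q⊆p X _) w))
    ...   | no no-bypass       = no λ w → case WalkIn-bypass x≢y w of λ where
        (inj₁ w′)     → x∉p-x X x (WalkIn-head w′)
        (inj₂ bypass) → no-bypass bypass

  ∈outside⁺ : v ∉ A → v ∈ outside G A
  ∈outside⁺ {A = A} = ∈-tabulate⌊⌋⁺ (λ v → ¬? (v ∈? A))

  ∈outside⁻ : v ∈ outside G A → v ∉ A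
  ∈outside⁻ {A = A} = ∈-tabulate⌊⌋⁻ (λ v → ¬? (v ∈? A))

  ∉outside⇒∈ : v ∉ outside G A → v ∈ A
  ∉outside⇒∈ {A = A} = decidable-stable (_ ∈? A) ∘ contraposition ∈outside⁺

  outside-antitone : A ⊆ B → outside G B ⊆ outside G A
  outside-antitone A⊆B v∈ = ∈outside⁺ (∈outside⁻ v∈ ∘ A⊆B)

  ∈Nbhd⁺ : v ∉ A → u ∈ A → Adj u v → v ∈ Nbhd G A
  ∈Nbhd⁺ {A = A} v∉A u∈A uv =
    ∈-tabulate⌊⌋⁺ (λ v → ¬? (v ∈? A) ×-dec any? (λ u → (u ∈? A) ×-dec adj? u v)) (v∉A , _ , u∈A , uv)

  ∈Nbhd⁻ : v ∈ Nbhd G A → v ∉ A × ∃[ u ] (u ∈ A × Adj u v)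
  ∈Nbhd⁻ {A = A} = ∈-tabulate⌊⌋⁻ (λ v → ¬? (v ∈? A) ×-dec any? (λ u → (u ∈? A) ×-dec adj? u v))

  ∈⇒∉Nbhd : v ∈ A → v ∉ Nbhd G A
  ∈⇒∉Nbhd v∈A v∈NA = proj₁ (∈Nbhd⁻ v∈NA) v∈A

  Nbhd-⊆ : A ⊆ B → v ∈ Nbhd G A → v ∉ B → v ∈ Nbhd G B
  Nbhd-⊆ A⊆B v∈NA v∉B with ∈Nbhd⁻ v∈NA
  ... | _ , u , u∈A , uv = ∈Nbhd⁺ v∉B (A⊆B u∈A) uv

  Adj-closed : ∀ {A x y} → y ∉ Nbhd G A → Adj x y → x ∈ A → y ∈ A
  Adj-closed {A} {y = y} y∉NA xy x∈A with y ∈? A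
  ... | yes y∈A = y∈A
  ... | no  y∉A = contradiction (∈Nbhd⁺ y∉A x∈A xy) y∉NA

  WalkIn-outside-Nbhd-cannot-leave : WalkIn G (outside G (Nbhd G A)) x y → x ∈ A → y ∈ A
  WalkIn-outside-Nbhd-cannot-leave (here _)       x∈A = x∈A
  WalkIn-outside-Nbhd-cannot-leave (step _ xx′ w) x∈A =
    WalkIn-outside-Nbhd-cannot-leave w (Adj-closed (∈outside⁻ (WalkIn-head w)) xx′ x∈A)

  WalkIn-outside-Nbhd-cannot-enter : WalkIn G (outside G (Nbhd G A)) x y → y ∈ A → x ∈ A
  WalkIn-outside-Nbhd-cannot-enter (here _)        y∈A = y∈A
  WalkIn-outside-Nbhd-cannot-enter (step x∈ xx′ w) y∈A =
    Adj-closed (∈outside⁻ x∈) (sym xx′) (WalkIn-outside-Nbhd-cannot-enter w y∈A)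

  Component : Subset n → Fin n → Subset n
  Component X t = tabulate (λ v → ⌊ WalkIn? X v t ⌋)

  ∈Component⁺ : WalkIn G X v t → v ∈ Component X t
  ∈Component⁺ {X = X} {t = t} = ∈-tabulate⌊⌋⁺ (λ v → WalkIn? X v t)

  ∈Component⁻ : v ∈ Component X t → WalkIn G X v t
  ∈Component⁻ {X = X} {t = t} = ∈-tabulate⌊⌋⁻ (λ v → WalkIn? X v t)

  Component⊆ : Component X t ⊆ X
  Component⊆ = WalkIn-head ∘ ∈Component⁻

  Connected⊆Component : Connected G A → t ∈ A → A ⊆ X → A ⊆ Component X t
  Connected⊆Component A-connected t∈A A⊆X v∈A =
    ∈Component⁺ (WalkIn-mono A⊆X (A-connected v∈A t∈A))

  Nbhd-Component-disjoint : v ∈ Nbhd G (Component X t) → v ∉ X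
  Nbhd-Component-disjoint v∈N v∈X with ∈Nbhd⁻ v∈N
  ... | v∉C , _ , u∈C , uv = v∉C (∈Component⁺ (step v∈X (sym uv) (∈Component⁻ u∈C)))

  minimal-separator-if-full : ∀ {s t Z} →
    IsSeparator G s t Z →
    (∀ {v} → v ∈ Z → ∃[ u ] (WalkIn G (outside G Z) s u × Adj u v)) →
    (∀ {v} → v ∈ Z → ∃[ w ] (Adj v w × WalkIn G (outside G Z) w t)) →
    IsMinimalSeparator G s t Z
  minimal-separator-if-full {s} {t} {Z} Z-separates s-side t-side = Z-separates , not-separator
    where
    not-separator : ∀ Z′ → Z′ ⊂ Z → ¬ IsSeparator G s t Z′
    not-separator Z′ (Z′⊆Z , v , v∈Z , v∉Z′) (_ , _ , no-walk)
      with s-side v∈Z | t-side v∈Z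
    ... | _ , su , uv | _ , vw , wt =
      no-walk (WalkIn-trans (avoid su) (step (WalkIn-last (avoid su)) uv (step (∈outside⁺ v∉Z′) vw (avoid wt))))
      where
      avoid : ∀ {x y} → WalkIn G (outside G Z) x y → WalkIn G (outside G Z′) x y
      avoid = WalkIn-mono (outside-antitone Z′⊆Z)

  Nbhd-Component-minimal-separator : ∀ {S s t} → s ∈ S → Connected G S → t ∉ S → t ∉ Nbhd G S →
    IsMinimalSeparator G s t (Nbhd G (Component (outside G (Nbhd G S)) t))
  Nbhd-Component-minimal-separator {S} {s} {t} s∈S S-connected t∉S t∉NS =
    minimal-separator-if-full (s∉Z , t∉Z , no-walk) s-side t-side
    where
    V∖NS : Subset n
    V∖NS = outside G (Nbhd G S)

    D : Subset n
    D = Component V∖NS t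

    Z : Subset n
    Z = Nbhd G D

    Z⊆NS : Z ⊆ Nbhd G S
    Z⊆NS = ∉outside⇒∈ ∘ Nbhd-Component-disjoint

    S⊆G-Z : S ⊆ outside G Z
    S⊆G-Z v∈S = ∈outside⁺ (∈⇒∉Nbhd v∈S ∘ Z⊆NS)

    V∖NS⊆G-Z : V∖NS ⊆ outside G Z
    V∖NS⊆G-Z = outside-antitone Z⊆NS

    t∈D : t ∈ D
    t∈D = ∈Component⁺ (here (∈outside⁺ t∉NS))

    s∉Z : s ∉ Z
    s∉Z = ∈⇒∉Nbhd s∈S ∘ Z⊆NS

    t∉Z : t ∉ Z
    t∉Z = ∈⇒∉Nbhd t∈D

    no-walk : ¬ WalkIn G (outside G Z) s t
    no-walk w = t∉S (WalkIn-outside-Nbhd-cannot-leave (∈Component⁻ s∈D) s∈S)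
      where
      s∈D : s ∈ D
      s∈D = WalkIn-outside-Nbhd-cannot-enter w t∈D

    s-side : ∀ {v} → v ∈ Z → ∃[ u ] (WalkIn G (outside G Z) s u × Adj u v)
    s-side v∈Z with ∈Nbhd⁻ (Z⊆NS v∈Z)
    ... | _ , u , u∈S , uv = u , WalkIn-mono S⊆G-Z (S-connected s∈S u∈S) , uv

    t-side : ∀ {v} → v ∈ Z → ∃[ w ] (Adj v w × WalkIn G (outside G Z) w t)
    t-side v∈Z with ∈Nbhd⁻ v∈Z
    ... | _ , w , w∈D , wv = w , sym wv , WalkIn-mono V∖NS⊆G-Z (∈Component⁻ w∈D)

lemma8 : ∀ {n} (G : Graph n) (s t : Fin n) (k : ℕ) → .{{NonZero k}} →
    (S T : Subset n) → s ∈ S → t ∈ T → Empty (S ∩ T) →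
    Connected G S → Connected G T → NoEdgeBetween G S T →
    ∣ Nbhd G S ∩ Nbhd G T ∣ ≥ k →
    ∃[ Z ] (IsMinimalSeparator G s t Z × ∣ Z ∣ ≥ k)
lemma8 {n} G s t k S T s∈S t∈T S∩T-empty S-connected T-connected no-edge k≤∣NS∩NT∣ =
  Nbhd G D ,
  Nbhd-Component-minimal-separator G s∈S S-connected t∉S (∈outside⁻ G (T⊆V∖NS t∈T)) ,
  ≤-trans k≤∣NS∩NT∣ (p⊆q⇒∣p∣≤∣q∣ NS∩NT⊆ND)
  where
  V∖NS : Subset n
  V∖NS = outside G (Nbhd G S)

  D : Subset n
  D = Component G V∖NS t

  t∉S : t ∉ S
  t∉S t∈S = S∩T-empty (t , x∈p∩q⁺ (t∈S , t∈T))

  T⊆V∖NS : T ⊆ V∖NS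
  T⊆V∖NS v∈T = ∈outside⁺ G λ v∈NS → let _ , _ , u∈S , uv = ∈Nbhd⁻ G v∈NS in no-edge u∈S v∈T uv

  NS∩NT⊆ND : Nbhd G S ∩ Nbhd G T ⊆ Nbhd G D
  NS∩NT⊆ND v∈NS∩NT =
    let v∈NS , v∈NT = x∈p∩q⁻ _ _ v∈NS∩NT
    in Nbhd-⊆ G (Connected⊆Component G T-connected t∈T T⊆V∖NS) v∈NT
         (λ v∈D → ∈outside⁻ G (Component⊆ G v∈D) v∈NS)
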